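{- Let $e\geq 3$ be an integer and let $n$ be a positive integer with $n\equiv 0 \pmod{4e}$. Then there exists an $e$-star system of order $n$ which is $(n-1)$-block-colourable.
   Context: For an integer $e\ge 1$, an $e$-star is a copy of the complete bipartite graph $K_{1,e}$. An $e$-star system of order $n$ is a pair $(V,\mathcal{B})$ where $|V|=n$ and $\mathcal{B}$ is a set of $e$-stars (subgraphs of the complete graph $K_n$ on $V$) whose edge sets partition the edge set of $K_n$; the elements of $\mathcal B$ are called blocks. A block-colouring of such a system is a partition of $\mathcal{B}$ into colour classes such that the blocks in each colour class are pairwise vertex-disjoint. The system is $k$-block-colourable if it admits a block-colouring with $k$ colour classes. -}

module Defs where

open import Data.Nat using (ℕ; suc; _*_)
open import Data.Fin using (Fin)
open import Data.Vec using (Vec; lookup)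
open import Data.Product using (Σ; ∃; ∃-syntax; _×_; _,_)
open import Data.Sum using (_⊎_)
open import Relation.Binary.PropositionalEquality using (_≡_; _≢_)
open import Relation.Nullary using (¬_)
open import Function.Definitions using (Injective; Surjective)

record Star (n e : ℕ) : Set where
  field
    centre       : Fin n
    leaves       : Vec (Fin n) e
    leaves-inj   : Injective _≡_ _≡_ (lookup leaves)
    leaves≢centre : ∀ i → lookup leaves i ≢ centre
open Star public

HasEdge : ∀ {n e} → Star n e → Fin n → Fin n → Set
HasEdge s u v =
  ∃[ i ] ((centre s ≡ u × lookup (leaves s) i ≡ v) ⊎ (centre s ≡ v × lookup (leaves s) i ≡ u))

HasVertex : ∀ {n e} → Star n e → Fin n → Set
HasVertex s x = centre s ≡ x ⊎ ∃[ i ] lookup (leaves s) i ≡ x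

record StarSystem (n e : ℕ) : Set where
  field
    m          : ℕ
    block      : Fin m → Star n e
    covers     : ∀ u v → u ≢ v → ∃[ b ] HasEdge (block b) u v
    edge-unique : ∀ u v b b' → u ≢ v → HasEdge (block b) u v → HasEdge (block b') u v → b ≡ b'
open StarSystem public

VertexDisjoint : ∀ {n e} → Star n e → Star n e → Set
VertexDisjoint s t = ∀ x → HasVertex s x → ¬ HasVertex t x

-- A block-colouring with k colour classes: a surjective assignment of colours
-- (so that there are exactly k nonempty colour classes) such that distinct
-- blocks of the same colour are vertex-disjoint.
BlockColourable : ∀ {n e} → StarSystem n e → ℕ → Set
BlockColourable S k =
  Σ (Fin (m S) → Fin k) λ col →
    Surjective _≡_ _≡_ col ×
    (∀ b b' → b ≢ b' → col b ≡ col b' → VertexDisjoint (block S b) (block S b'))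

-- Let N = n − 1 = 2h + 1 and h + 1 = K e, and take the vertex set ℤ_N ∪ {∞}. For v ∈ ℤ_N and
-- 0 ≤ j < K the star (v, j) has centre v and leaves v + 2a for the e offsets a = e j + t
-- (0 ≤ t < e), the offset 0 standing for the leaf ∞. As N is odd, for x ≠ y exactly one of
-- y − x, x − y is 2a with 1 ≤ a ≤ h, so every edge lies in exactly one star.
-- Colour the star (v, j) by v + j. Measured from its colour, the finite vertices of (v, j) sit
-- at −j and at j (2e − 1) + 2t: for j ≥ 1 the first lies in [K (2e − 1), N), and the others fill
-- the j-th block of length 2e − 1 below K (2e − 1). So the layer j can be decoded from any
-- common vertex, which makes stars of one colour vertex-disjoint; the N colours all occur.

module Submission where

open import Defs
open import Data.Nat using (ℕ; _≤_; _*_; _∸_; NonZero)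
open import Data.Nat.Divisibility using (_∣_)
open import Data.Product using (Σ)

open import Data.Nat using (zero; suc; _+_; _<_; z≤n; s≤s; s≤s⁻¹; z<s; >-nonZero⁻¹; _<?_)
open import Data.Nat.Properties
open import Data.Nat.DivMod
open import Data.Nat.Divisibility using (divides; divides-refl)
open import Data.Nat.Tactic.RingSolver using (solve-∀)
open import Data.Fin using (Fin; toℕ; fromℕ; fromℕ<; inject₁; combine; remQuot)
open import Data.Fin.Properties
  using (toℕ-injective; toℕ-fromℕ<; toℕ<n; fromℕ≢inject₁; inject₁-injective; toℕ-combine;
         combine-injectiveˡ; combine-injectiveʳ; combine-surjective; combine-remQuot; remQuot-combine)
open import Data.Vec using (lookup; tabulate)
open import Data.Vec.Properties using (lookup∘tabulate)
open import Data.Product using (∃-syntax; _×_; _,_; uncurry)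
open import Data.Sum using (_⊎_; inj₁; inj₂)
open import Data.Empty using (⊥; ⊥-elim)
open import Function using (_∘_)
open import Function.Definitions using (Surjective)
open import Relation.Binary.PropositionalEquality
open import Relation.Nullary using (yes; no; contradiction)

m+[n+[o∸m]]≡n+o : ∀ {m o} n → m ≤ o → m + (n + (o ∸ m)) ≡ n + o
m+[n+[o∸m]]≡n+o {m} {o} n m≤o = begin
  m + (n + (o ∸ m)) ≡⟨ +-assoc m n (o ∸ m) ⟨
  m + n + (o ∸ m)   ≡⟨ cong (_+ (o ∸ m)) (+-comm m n) ⟩
  n + m + (o ∸ m)   ≡⟨ +-assoc n m (o ∸ m) ⟩
  n + (m + (o ∸ m)) ≡⟨ cong (n +_) (m+[n∸m]≡n m≤o) ⟩
  n + o             ∎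
  where open ≡-Reasoning

data LastView {n : ℕ} : Fin (suc n) → Set where
  last   : LastView (fromℕ n)
  inject : (i : Fin n) → LastView (inject₁ i)

lastView : ∀ {n} (i : Fin (suc n)) → LastView i
lastView {zero}  Fin.zero    = last
lastView {suc n} Fin.zero    = inject Fin.zero
lastView {suc n} (Fin.suc i) with lastView i
... | last     = last
... | inject j = inject (Fin.suc j)

remQuot-injective : ∀ {m} n {b b′ : Fin (m * n)} → remQuot {m} n b ≡ remQuot n b′ → b ≡ b′
remQuot-injective {m} n {b} {b′} eq = begin
  b                                  ≡⟨ combine-remQuot {m} n b ⟨
  uncurry combine (remQuot {m} n b)  ≡⟨ cong (uncurry combine) eq ⟩
  uncurry combine (remQuot {m} n b′) ≡⟨ combine-remQuot {m} n b′ ⟩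
  b′                                 ∎
  where open ≡-Reasoning

even-or-odd : ∀ d → ∃[ q ] (d ≡ 2 * q ⊎ d ≡ suc (2 * q))
even-or-odd zero = 0 , inj₁ refl
even-or-odd (suc d) with even-or-odd d
... | q , inj₁ refl = q , inj₂ refl
... | q , inj₂ refl = suc q , inj₁ (cong suc (sym (+-suc q (q + 0))))

module Cyclic (N : ℕ) .{{_ : NonZero N}} where

  [m%N+n]%N≡[m+n]%N : ∀ m n → (m % N + n) % N ≡ (m + n) % N
  [m%N+n]%N≡[m+n]%N m n = begin
    (m % N + n) % N           ≡⟨ %-distribˡ-+ (m % N) n N ⟩
    (m % N % N + n % N) % N   ≡⟨ cong (λ k → (k + n % N) % N) (m%n%n≡m%n m N) ⟩
    (m % N + n % N) % N       ≡⟨ %-distribˡ-+ m n N ⟨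
    (m + n) % N               ∎
    where open ≡-Reasoning

  [m+n%N]%N≡[m+n]%N : ∀ m n → (m + n % N) % N ≡ (m + n) % N
  [m+n%N]%N≡[m+n]%N m n = begin
    (m + n % N) % N ≡⟨ cong (_% N) (+-comm m (n % N)) ⟩
    (n % N + m) % N ≡⟨ [m%N+n]%N≡[m+n]%N n m ⟩
    (n + m) % N     ≡⟨ cong (_% N) (+-comm n m) ⟩
    (m + n) % N     ∎
    where open ≡-Reasoning

  m%N≡0⇒m≡N : ∀ {m} → 0 < m → m < N + N → m % N ≡ 0 → m ≡ N
  m%N≡0⇒m≡N {m} 0<m m<2N m%N≡0 with m <? N
  ... | yes m<N = contradiction (trans (sym (m<n⇒m%n≡m m<N)) m%N≡0) (m<n⇒n≢0 0<m)
  ... | no m≮N = ≤-antisym (m∸n≡0⇒m≤n m∸N≡0) N≤m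
    where
    N≤m : N ≤ m
    N≤m = ≮⇒≥ m≮N
    m∸N≡0 : m ∸ N ≡ 0
    m∸N≡0 = begin
      m ∸ N         ≡⟨ m<n⇒m%n≡m (m<n+o⇒m∸n<o m N m<2N) ⟨
      (m ∸ N) % N   ≡⟨ m≤n⇒[n∸m]%m≡n%m N≤m ⟩
      m % N         ≡⟨ m%N≡0 ⟩
      0             ∎
      where open ≡-Reasoning

  infixl 6 _⊕_

  -- Opaque, so that x ⊕ a and δ x y stay rigid under unification instead of unfolding to _%_.
  opaque
    _⊕_ : Fin N → ℕ → Fin N
    x ⊕ a = (toℕ x + a) mod N

    toℕ-⊕ : ∀ x a → toℕ (x ⊕ a) ≡ (toℕ x + a) % N
    toℕ-⊕ x a = toℕ-fromℕ< (m%n<n (toℕ x + a) N)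

    δ : Fin N → Fin N → ℕ
    δ x y = (toℕ y + (N ∸ toℕ x)) % N

    δ-def : ∀ x y → δ x y ≡ (toℕ y + (N ∸ toℕ x)) % N
    δ-def x y = refl

  ⊕-≡ : ∀ {x y a} → toℕ x + a ≡ toℕ y + N → x ⊕ a ≡ y
  ⊕-≡ {x} {y} {a} eq = toℕ-injective (begin
    toℕ (x ⊕ a)        ≡⟨ toℕ-⊕ x a ⟩
    (toℕ x + a) % N    ≡⟨ cong (_% N) eq ⟩
    (toℕ y + N) % N    ≡⟨ [m+n]%n≡m%n (toℕ y) N ⟩
    toℕ y % N          ≡⟨ m<n⇒m%n≡m (toℕ<n y) ⟩
    toℕ y              ∎)
    where open ≡-Reasoning

  ⊕-identityʳ : ∀ x → x ⊕ 0 ≡ x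
  ⊕-identityʳ x = toℕ-injective (begin
    toℕ (x ⊕ 0)        ≡⟨ toℕ-⊕ x 0 ⟩
    (toℕ x + 0) % N    ≡⟨ cong (_% N) (+-identityʳ (toℕ x)) ⟩
    toℕ x % N          ≡⟨ m<n⇒m%n≡m (toℕ<n x) ⟩
    toℕ x              ∎)
    where open ≡-Reasoning

  ⊕-assoc : ∀ x a b → x ⊕ a ⊕ b ≡ x ⊕ (a + b)
  ⊕-assoc x a b = toℕ-injective (begin
    toℕ (x ⊕ a ⊕ b)              ≡⟨ toℕ-⊕ (x ⊕ a) b ⟩
    (toℕ (x ⊕ a) + b) % N        ≡⟨ cong (λ k → (k + b) % N) (toℕ-⊕ x a) ⟩
    ((toℕ x + a) % N + b) % N    ≡⟨ [m%N+n]%N≡[m+n]%N (toℕ x + a) b ⟩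
    (toℕ x + a + b) % N          ≡⟨ cong (_% N) (+-assoc (toℕ x) a b) ⟩
    (toℕ x + (a + b)) % N        ≡⟨ toℕ-⊕ x (a + b) ⟨
    toℕ (x ⊕ (a + b))            ∎)
    where open ≡-Reasoning

  ⊕-+N : ∀ x a → x ⊕ (a + N) ≡ x ⊕ a
  ⊕-+N x a = toℕ-injective (begin
    toℕ (x ⊕ (a + N))       ≡⟨ toℕ-⊕ x (a + N) ⟩
    (toℕ x + (a + N)) % N   ≡⟨ cong (_% N) (+-assoc (toℕ x) a N) ⟨
    (toℕ x + a + N) % N     ≡⟨ [m+n]%n≡m%n (toℕ x + a) N ⟩
    (toℕ x + a) % N         ≡⟨ toℕ-⊕ x a ⟨
    toℕ (x ⊕ a)             ∎)
    where open ≡-Reasoning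

  ⊕-mod : ∀ x a → x ⊕ (a % N) ≡ x ⊕ a
  ⊕-mod x a = toℕ-injective (begin
    toℕ (x ⊕ (a % N))       ≡⟨ toℕ-⊕ x (a % N) ⟩
    (toℕ x + a % N) % N     ≡⟨ [m+n%N]%N≡[m+n]%N (toℕ x) a ⟩
    (toℕ x + a) % N         ≡⟨ toℕ-⊕ x a ⟨
    toℕ (x ⊕ a)             ∎)
    where open ≡-Reasoning

  δ<N : ∀ x y → δ x y < N
  δ<N x y = subst (_< N) (sym (δ-def x y)) (m%n<n (toℕ y + (N ∸ toℕ x)) N)

  ⊕-δ : ∀ x y → x ⊕ δ x y ≡ y
  ⊕-δ x y = begin
    x ⊕ δ x y                        ≡⟨ cong (x ⊕_) (δ-def x y) ⟩
    x ⊕ ((toℕ y + (N ∸ toℕ x)) % N)  ≡⟨ ⊕-mod x (toℕ y + (N ∸ toℕ x)) ⟩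
    x ⊕ (toℕ y + (N ∸ toℕ x))        ≡⟨ ⊕-≡ {x} (m+[n+[o∸m]]≡n+o (toℕ y) (<⇒≤ (toℕ<n x))) ⟩
    y                                ∎
    where open ≡-Reasoning

  δ-⊕ : ∀ x a → δ x (x ⊕ a) ≡ a % N
  δ-⊕ x a = begin
    δ x (x ⊕ a)                            ≡⟨ δ-def x (x ⊕ a) ⟩
    (toℕ (x ⊕ a) + (N ∸ toℕ x)) % N        ≡⟨ cong (λ k → (k + (N ∸ toℕ x)) % N) (toℕ-⊕ x a) ⟩
    ((toℕ x + a) % N + (N ∸ toℕ x)) % N    ≡⟨ [m%N+n]%N≡[m+n]%N (toℕ x + a) (N ∸ toℕ x) ⟩
    (toℕ x + a + (N ∸ toℕ x)) % N          ≡⟨ cong (_% N) (+-assoc (toℕ x) a (N ∸ toℕ x)) ⟩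
    (toℕ x + (a + (N ∸ toℕ x))) % N        ≡⟨ cong (_% N) (m+[n+[o∸m]]≡n+o a (<⇒≤ (toℕ<n x))) ⟩
    (a + N) % N                            ≡⟨ [m+n]%n≡m%n a N ⟩
    a % N                                  ∎
    where open ≡-Reasoning

  δ-⊕-< : ∀ x {a} → a < N → δ x (x ⊕ a) ≡ a
  δ-⊕-< x {a} a<N = trans (δ-⊕ x a) (m<n⇒m%n≡m a<N)

  δ-injective : ∀ x {y z} → δ x y ≡ δ x z → y ≡ z
  δ-injective x {y} {z} eq = trans (sym (⊕-δ x y)) (trans (cong (x ⊕_) eq) (⊕-δ x z))

  δ-self : ∀ x → δ x x ≡ 0
  δ-self x = trans (cong (δ x) (sym (⊕-identityʳ x))) (δ-⊕-< x (>-nonZero⁻¹ N))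

  δ≡0⇒≡ : ∀ {x y} → δ x y ≡ 0 → x ≡ y
  δ≡0⇒≡ {x} eq = δ-injective x (trans (δ-self x) (sym eq))

  δ+δ≡N : ∀ {x y} → x ≢ y → δ x y + δ y x ≡ N
  δ+δ≡N {x} {y} x≢y = m%N≡0⇒m≡N 0<s (+-mono-< (δ<N x y) (δ<N y x)) s%N≡0
    where
    s : ℕ
    s = δ x y + δ y x
    0<s : 0 < s
    0<s = ≤-trans (n≢0⇒n>0 (x≢y ∘ δ≡0⇒≡)) (m≤m+n (δ x y) (δ y x))
    s%N≡0 : s % N ≡ 0
    s%N≡0 = begin
      s % N          ≡⟨ δ-⊕ x s ⟨
      δ x (x ⊕ s)    ≡⟨ cong (δ x) (sym (⊕-assoc x (δ x y) (δ y x))) ⟩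
      δ x (x ⊕ δ x y ⊕ δ y x) ≡⟨ cong (λ z → δ x (z ⊕ δ y x)) (⊕-δ x y) ⟩
      δ x (y ⊕ δ y x) ≡⟨ cong (δ x) (⊕-δ y x) ⟩
      δ x x          ≡⟨ δ-self x ⟩
      0              ∎
      where open ≡-Reasoning

  δ-⊕-⊕ : ∀ x {a} b → a ≤ N → δ (x ⊕ a) (x ⊕ b) ≡ (b + (N ∸ a)) % N
  δ-⊕-⊕ x {a} b a≤N = begin
    δ (x ⊕ a) (x ⊕ b)                          ≡⟨ cong (δ (x ⊕ a)) shift ⟨
    δ (x ⊕ a) (x ⊕ a ⊕ (b + (N ∸ a)))          ≡⟨ δ-⊕ (x ⊕ a) (b + (N ∸ a)) ⟩
    (b + (N ∸ a)) % N                          ∎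
    where
    open ≡-Reasoning
    shift : x ⊕ a ⊕ (b + (N ∸ a)) ≡ x ⊕ b
    shift = begin
      x ⊕ a ⊕ (b + (N ∸ a))   ≡⟨ ⊕-assoc x a (b + (N ∸ a)) ⟩
      x ⊕ (a + (b + (N ∸ a))) ≡⟨ cong (x ⊕_) (m+[n+[o∸m]]≡n+o b a≤N) ⟩
      x ⊕ (b + N)             ≡⟨ ⊕-+N x b ⟩
      x ⊕ b                   ∎

  ⊕-cancelʳ : ∀ {x y a} → a ≤ N → x ⊕ a ≡ y ⊕ a → x ≡ y
  ⊕-cancelʳ {x} {y} {a} a≤N eq = δ-injective (x ⊕ a) (begin
    δ (x ⊕ a) x         ≡⟨ cong (δ (x ⊕ a)) (⊕-identityʳ x) ⟨
    δ (x ⊕ a) (x ⊕ 0)   ≡⟨ δ-⊕-⊕ x 0 a≤N ⟩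
    (N ∸ a) % N         ≡⟨ δ-⊕-⊕ y 0 a≤N ⟨
    δ (y ⊕ a) (y ⊕ 0)   ≡⟨ cong₂ δ (sym eq) (⊕-identityʳ y) ⟩
    δ (x ⊕ a) y         ∎)
    where open ≡-Reasoning

module CyclicStarSystem (e₁ K₁ : ℕ) where

  e K h N : ℕ
  e = suc e₁
  K = suc K₁
  h = e₁ + K₁ * e
  N = suc (2 * h)

  open Cyclic N

  ∞ : Fin (suc N)
  ∞ = fromℕ N

  leaf : Fin N → ℕ → Fin (suc N)
  leaf v zero    = ∞
  leaf v (suc a) = inject₁ (v ⊕ 2 * suc a)

  leaf-cases : ∀ v a → (leaf v a ≡ ∞ × a ≡ 0) ⊎ leaf v a ≡ inject₁ (v ⊕ 2 * a)
  leaf-cases v zero    = inj₁ (refl , refl)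
  leaf-cases v (suc a) = inj₂ refl

  2*a<N : ∀ {a} → a ≤ h → 2 * a < N
  2*a<N a≤h = s≤s (*-monoʳ-≤ 2 a≤h)

  δ-leaf : ∀ {v w a} → suc a ≤ h → leaf v (suc a) ≡ inject₁ w → δ v w ≡ 2 * suc a
  δ-leaf {v} a≤h eq = trans (cong (δ v) (sym (inject₁-injective eq))) (δ-⊕-< v (2*a<N a≤h))

  leaf-δ : ∀ {x y a} → 0 < a → δ x y ≡ 2 * a → leaf x a ≡ inject₁ y
  leaf-δ {x} {y} (s≤s _) eq = cong inject₁ (trans (cong (x ⊕_) (sym eq)) (⊕-δ x y))

  leaf-injective : ∀ {v a b} → a ≤ h → b ≤ h → leaf v a ≡ leaf v b → a ≡ b
  leaf-injective {a = zero}  {zero}  _   _   _  = refl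
  leaf-injective {a = zero}  {suc b} _   _   eq = contradiction eq fromℕ≢inject₁
  leaf-injective {a = suc a} {zero}  _   _   eq = contradiction (sym eq) fromℕ≢inject₁
  leaf-injective {a = suc a} {suc b} a≤h b≤h eq =
    *-cancelˡ-≡ (suc a) (suc b) 2 (trans (sym (δ-leaf a≤h refl)) (δ-leaf b≤h (sym eq)))

  leaf≢centre : ∀ {v a} → a ≤ h → leaf v a ≢ inject₁ v
  leaf≢centre {a = zero}  _   = fromℕ≢inject₁
  leaf≢centre {v} {suc a} a≤h eq = 0≢1+n (trans (sym (δ-self v)) (δ-leaf a≤h eq))

  leaf-not-opposite : ∀ {v w a b} → a ≤ h → b ≤ h → leaf v a ≡ inject₁ w → leaf w b ≡ inject₁ v → ⊥
  leaf-not-opposite {a = zero}          _   _   eq _   = fromℕ≢inject₁ eq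
  leaf-not-opposite {a = suc a} {zero}  _   _   _  eq′ = fromℕ≢inject₁ eq′
  leaf-not-opposite {v} {w} {suc a} {suc b} a≤h b≤h eq eq′ = even≢odd (suc a + suc b) h (begin
    2 * (suc a + suc b)         ≡⟨ *-distribˡ-+ 2 (suc a) (suc b) ⟩
    2 * suc a + 2 * suc b       ≡⟨ cong₂ _+_ δvw δwv ⟨
    δ v w + δ w v               ≡⟨ δ+δ≡N v≢w ⟩
    N                           ∎)
    where
    open ≡-Reasoning
    δvw : δ v w ≡ 2 * suc a
    δvw = δ-leaf a≤h eq
    δwv : δ w v ≡ 2 * suc b
    δwv = δ-leaf b≤h eq′
    v≢w : v ≢ w
    v≢w refl = 0≢1+n (trans (sym (δ-self v)) δvw)

  arc-between : ∀ {x y} → x ≢ y → ∃[ a ] a ≤ h × (leaf x a ≡ inject₁ y ⊎ leaf y a ≡ inject₁ x)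
  arc-between {x} {y} x≢y with even-or-odd (δ x y)
  ... | zero , inj₁ δ≡0 = contradiction (δ≡0⇒≡ δ≡0) x≢y
  ... | suc q , inj₁ δ≡2q =
    suc q , *-cancelˡ-≤ 2 (s≤s⁻¹ (subst (_< N) δ≡2q (δ<N x y))) , inj₁ (leaf-δ z<s δ≡2q)
  ... | q , inj₂ δ≡odd = h ∸ q , m∸n≤m h q , inj₂ (leaf-δ (m<n⇒0<n∸m q<h) δyx)
    where
    open ≡-Reasoning
    q<h : q < h
    q<h = *-cancelˡ-< 2 q h (s≤s⁻¹ (subst (_< N) δ≡odd (δ<N x y)))
    δyx : δ y x ≡ 2 * (h ∸ q)
    δyx = begin
      δ y x                   ≡⟨ m+n∸m≡n (δ x y) (δ y x) ⟨
      δ x y + δ y x ∸ δ x y   ≡⟨ cong₂ _∸_ (δ+δ≡N x≢y) δ≡odd ⟩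
      N ∸ suc (2 * q)         ≡⟨ *-distribˡ-∸ 2 h q ⟨
      2 * (h ∸ q)             ∎

  offset : Fin K → Fin e → ℕ
  offset j t = toℕ (combine j t)

  offset≤h : ∀ j t → offset j t ≤ h
  offset≤h j t = s≤s⁻¹ (toℕ<n (combine j t))

  offset-injectiveˡ : ∀ {j t j′ t′} → offset j t ≡ offset j′ t′ → j ≡ j′
  offset-injectiveˡ {j} {t} {j′} {t′} eq = combine-injectiveˡ j t j′ t′ (toℕ-injective eq)

  offset-surjective : ∀ {a} → a ≤ h → ∃[ j ] ∃[ t ] offset j t ≡ a
  offset-surjective a≤h with j , t , combine≡ ← combine-surjective {K} {e} (fromℕ< (s≤s a≤h)) =
    j , t , trans (cong toℕ combine≡) (toℕ-fromℕ< (s≤s a≤h))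

  offset≡0⇒j≡0 : ∀ j t → offset j t ≡ 0 → toℕ j ≡ 0
  offset≡0⇒j≡0 j t eq = m+n≡0⇒m≡0 (toℕ j) (m+n≡0⇒m≡0 (e * toℕ j) (trans (sym (toℕ-combine j t)) eq))

  star : Fin N × Fin K → Star (suc N) e
  star (v , j) = record
    { centre        = inject₁ v
    ; leaves        = tabulate (leaf v ∘ offset j)
    ; leaves-inj    = λ {t} {t′} eq → combine-injectiveʳ j t j t′ (toℕ-injective
        (leaf-injective (offset≤h j t) (offset≤h j t′)
          (trans (sym (lookup∘tabulate (leaf v ∘ offset j) t)) (trans eq (lookup∘tabulate (leaf v ∘ offset j) t′)))))
    ; leaves≢centre = λ t → leaf≢centre (offset≤h j t) ∘ trans (sym (lookup∘tabulate (leaf v ∘ offset j) t))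
    }

  lookup-leaves : ∀ v j t → lookup (leaves (star (v , j))) t ≡ leaf v (offset j t)
  lookup-leaves v j t = lookup∘tabulate (leaf v ∘ offset j) t

  Arc : Fin N × Fin K → Fin (suc N) → Fin (suc N) → Set
  Arc (v , j) u w = ∃[ t ] inject₁ v ≡ u × leaf v (offset j t) ≡ w

  hasEdge⇒arc : ∀ p {u w} → HasEdge (star p) u w → Arc p u w ⊎ Arc p w u
  hasEdge⇒arc (v , j) (t , inj₁ (c , l)) = inj₁ (t , c , trans (sym (lookup-leaves v j t)) l)
  hasEdge⇒arc (v , j) (t , inj₂ (c , l)) = inj₂ (t , c , trans (sym (lookup-leaves v j t)) l)

  arc⇒hasEdge : ∀ p {u w} → Arc p u w ⊎ Arc p w u → HasEdge (star p) u w
  arc⇒hasEdge (v , j) (inj₁ (t , c , l)) = t , inj₁ (c , trans (lookup-leaves v j t) l)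
  arc⇒hasEdge (v , j) (inj₂ (t , c , l)) = t , inj₂ (c , trans (lookup-leaves v j t) l)

  arc-unique : ∀ p p′ {u w} → Arc p u w → Arc p′ u w → p ≡ p′
  arc-unique (v , j) (v′ , j′) (t , refl , l) (t′ , c′ , l′) with inject₁-injective c′
  ... | refl = cong (v ,_) (offset-injectiveˡ (leaf-injective (offset≤h j t) (offset≤h j′ t′) (trans l (sym l′))))

  no-opposite-arcs : ∀ p p′ {u w} → Arc p u w → Arc p′ w u → ⊥
  no-opposite-arcs (_ , j) (_ , j′) (t , refl , l) (t′ , refl , l′) =
    leaf-not-opposite (offset≤h j t) (offset≤h j′ t′) l l′

  star-edge-unique : ∀ p p′ {u w} → HasEdge (star p) u w → HasEdge (star p′) u w → p ≡ p′
  star-edge-unique p p′ uw uw′ with hasEdge⇒arc p uw | hasEdge⇒arc p′ uw′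
  ... | inj₁ arc | inj₁ arc′ = arc-unique p p′ arc arc′
  ... | inj₂ arc | inj₂ arc′ = arc-unique p p′ arc arc′
  ... | inj₁ arc | inj₂ arc′ = ⊥-elim (no-opposite-arcs p p′ arc arc′)
  ... | inj₂ arc | inj₁ arc′ = ⊥-elim (no-opposite-arcs p′ p arc′ arc)

  leaf-arc : ∀ {v a w} → a ≤ h → leaf v a ≡ w → ∃[ j ] Arc (v , j) (inject₁ v) w
  leaf-arc {v} a≤h eq with j , t , offset≡a ← offset-surjective a≤h =
    j , t , refl , trans (cong (leaf v) offset≡a) eq

  edge-covered : ∀ u w → u ≢ w → ∃[ p ] (Arc p u w ⊎ Arc p w u)
  edge-covered u w u≢w with lastView u | lastView w
  ... | last     | last     = contradiction refl u≢w
  ... | last     | inject y = let j , arc = leaf-arc {y} {0} z≤n refl in (y , j) , inj₂ arc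
  ... | inject x | last     = let j , arc = leaf-arc {x} {0} z≤n refl in (x , j) , inj₁ arc
  ... | inject x | inject y with arc-between (u≢w ∘ cong inject₁)
  ...   | a , a≤h , inj₁ l = let j , arc = leaf-arc a≤h l in (x , j) , inj₁ arc
  ...   | a , a≤h , inj₂ l = let j , arc = leaf-arc a≤h l in (y , j) , inj₂ arc

  starSystem : StarSystem (suc N) e
  starSystem = record
    { m           = N * K
    ; block       = star ∘ remQuot K
    ; covers      = λ u w u≢w → let (v , j) , arcs = edge-covered u w u≢w in
        combine v j , subst (λ p → HasEdge (star p) u w) (sym (remQuot-combine v j)) (arc⇒hasEdge (v , j) arcs)
    ; edge-unique = λ _ _ b b′ _ uw uw′ → remQuot-injective K (star-edge-unique _ _ uw uw′)
    }

  E′ : ℕ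
  E′ = suc (2 * e₁)

  K*E′+K≡1+N : K * E′ + K ≡ suc N
  K*E′+K≡1+N = identity e₁ K₁
    where
    identity : ∀ a b → suc b * suc (2 * a) + suc b ≡ suc (suc (2 * (a + b * suc a)))
    identity = solve-∀

  K*E′≤N : K * E′ ≤ N
  K*E′≤N = s≤s⁻¹ (subst (K * E′ <_) K*E′+K≡1+N (m<m+n (K * E′) z<s))

  toℕ≤N : ∀ (j : Fin K) → toℕ j ≤ N
  toℕ≤N j = s≤s⁻¹ (≤-trans (toℕ<n j) (subst (K ≤_) K*E′+K≡1+N (m≤n+m K (K * E′))))

  decode : ℕ → ℕ
  decode w with w <? K * E′
  ... | yes _ = w / E′
  ... | no  _ = N ∸ w

  decode-< : ∀ {w} → w < K * E′ → decode w ≡ w / E′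
  decode-< {w} w< with w <? K * E′
  ... | yes _  = refl
  ... | no  w≮ = contradiction w< w≮

  decode-≥ : ∀ {w} → K * E′ ≤ w → decode w ≡ N ∸ w
  decode-≥ {w} w≥ with w <? K * E′
  ... | yes w< = contradiction w≥ (<⇒≱ w<)
  ... | no  _  = refl

  decode-centre : ∀ i → i < K → decode ((N ∸ i) % N) ≡ i
  decode-centre zero _ = trans (cong decode (n%n≡0 N)) (decode-< z<s)
  decode-centre (suc i) i<K = begin
    decode ((N ∸ suc i) % N)  ≡⟨ cong decode (m<n⇒m%n≡m (s≤s (m∸n≤m (2 * h) i))) ⟩
    decode (N ∸ suc i)        ≡⟨ decode-≥ (m+n≤o⇒m≤o∸n (K * E′) K*E′+i≤N) ⟩
    N ∸ (N ∸ suc i)           ≡⟨ m∸[m∸n]≡n (≤-trans (m≤n+m (suc i) (K * E′)) K*E′+i≤N) ⟩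
    suc i                     ∎
    where
    open ≡-Reasoning
    K*E′+i≤N : K * E′ + suc i ≤ N
    K*E′+i≤N = s≤s⁻¹ (subst (K * E′ + suc i <_) K*E′+K≡1+N (+-monoʳ-< (K * E′) i<K))

  2*t<E′ : ∀ (t : Fin e) → 2 * toℕ t < E′
  2*t<E′ t = s≤s (*-monoʳ-≤ 2 (s≤s⁻¹ (toℕ<n t)))

  leaf-code<K*E′ : ∀ (j : Fin K) t → toℕ j * E′ + 2 * toℕ t < K * E′
  leaf-code<K*E′ j t = begin-strict
    toℕ j * E′ + 2 * toℕ t  <⟨ +-monoʳ-< (toℕ j * E′) (2*t<E′ t) ⟩
    toℕ j * E′ + E′         ≡⟨ +-comm (toℕ j * E′) E′ ⟩
    suc (toℕ j) * E′        ≤⟨ *-monoˡ-≤ E′ (toℕ<n j) ⟩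
    K * E′                  ∎
    where open ≤-Reasoning

  code-leaf : ∀ j t → (2 * offset j t + (N ∸ toℕ j)) % N ≡ toℕ j * E′ + 2 * toℕ t
  code-leaf j t = begin
    (2 * offset j t + (N ∸ a)) % N         ≡⟨ cong (λ o → (2 * o + (N ∸ a)) % N) (toℕ-combine j t) ⟩
    (2 * (e * a + b) + (N ∸ a)) % N        ≡⟨ cong (λ o → (o + (N ∸ a)) % N) (identity e₁ a b) ⟩
    (a * E′ + 2 * b + a + (N ∸ a)) % N     ≡⟨ cong (_% N) (+-assoc (a * E′ + 2 * b) a (N ∸ a)) ⟩
    (a * E′ + 2 * b + (a + (N ∸ a))) % N   ≡⟨ cong (λ o → (a * E′ + 2 * b + o) % N) (m+[n∸m]≡n (toℕ≤N j)) ⟩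
    (a * E′ + 2 * b + N) % N               ≡⟨ [m+n]%n≡m%n (a * E′ + 2 * b) N ⟩
    (a * E′ + 2 * b) % N                   ≡⟨ m<n⇒m%n≡m (<-≤-trans (leaf-code<K*E′ j t) K*E′≤N) ⟩
    a * E′ + 2 * b                         ∎
    where
    open ≡-Reasoning
    a b : ℕ
    a = toℕ j
    b = toℕ t
    identity : ∀ c j t → 2 * (suc c * j + t) ≡ j * suc (2 * c) + 2 * t + j
    identity = solve-∀

  decode-leaf : ∀ j t → decode (toℕ j * E′ + 2 * toℕ t) ≡ toℕ j
  decode-leaf j t = begin
    decode (toℕ j * E′ + 2 * toℕ t)        ≡⟨ decode-< (leaf-code<K*E′ j t) ⟩
    (toℕ j * E′ + 2 * toℕ t) / E′          ≡⟨ +-distrib-/-∣ˡ (2 * toℕ t) (divides-refl (toℕ j)) ⟩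
    toℕ j * E′ / E′ + 2 * toℕ t / E′       ≡⟨ cong₂ _+_ (m*n/n≡m (toℕ j) E′) (m<n⇒m/n≡0 (2*t<E′ t)) ⟩
    toℕ j + 0                              ≡⟨ +-identityʳ (toℕ j) ⟩
    toℕ j                                  ∎
    where open ≡-Reasoning

  Displacement : Fin K → ℕ → Set
  Displacement j β = β ≡ 0 ⊎ ∃[ t ] β ≡ 2 * offset j t

  colour : Fin N × Fin K → Fin N
  colour (v , j) = v ⊕ toℕ j

  decode-δ-colour : ∀ v j {β} → Displacement j β → decode (δ (colour (v , j)) (v ⊕ β)) ≡ toℕ j
  decode-δ-colour v j {β} d = trans (cong decode (δ-⊕-⊕ v β (toℕ≤N j))) (decode-code d)
    where
    decode-code : Displacement j β → decode ((β + (N ∸ toℕ j)) % N) ≡ toℕ j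
    decode-code (inj₁ refl)       = decode-centre (toℕ j) (toℕ<n j)
    decode-code (inj₂ (t , refl)) = trans (cong decode (code-leaf j t)) (decode-leaf j t)

  star-vertex : ∀ v j {x} → HasVertex (star (v , j)) x →
                (x ≡ ∞ × toℕ j ≡ 0) ⊎ ∃[ β ] Displacement j β × x ≡ inject₁ (v ⊕ β)
  star-vertex v j (inj₁ refl)    = inj₂ (0 , inj₁ refl , cong inject₁ (sym (⊕-identityʳ v)))
  star-vertex v j (inj₂ (t , l)) with leaf-cases v (offset j t) | trans (sym (lookup-leaves v j t)) l
  ... | inj₁ (l∞ , o≡0) | l′ = inj₁ (trans (sym l′) l∞ , offset≡0⇒j≡0 j t o≡0)
  ... | inj₂ lfin       | l′ = inj₂ (2 * offset j t , inj₂ (t , refl) , trans (sym l′) lfin)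

  same-colour-common-vertex⇒same-layer : ∀ {v j v′ j′ x} → colour (v , j) ≡ colour (v′ , j′) →
    HasVertex (star (v , j)) x → HasVertex (star (v′ , j′)) x → toℕ j ≡ toℕ j′
  same-colour-common-vertex⇒same-layer {v} {j} {v′} {j′} same x∈ x∈′
    with star-vertex v j x∈ | star-vertex v′ j′ x∈′
  ... | inj₁ (_ , j≡0)        | inj₁ (_ , j′≡0)      = trans j≡0 (sym j′≡0)
  ... | inj₁ (refl , _)       | inj₂ (_ , _ , ∞≡)    = contradiction ∞≡ fromℕ≢inject₁
  ... | inj₂ (_ , _ , ∞≡)     | inj₁ (refl , _)      = contradiction ∞≡ fromℕ≢inject₁
  ... | inj₂ (β , d , refl)   | inj₂ (β′ , d′ , x≡)  = begin
    toℕ j                                   ≡⟨ decode-δ-colour v j d ⟨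
    decode (δ (colour (v , j)) (v ⊕ β))     ≡⟨ cong₂ (λ c y → decode (δ c y)) same (inject₁-injective x≡) ⟩
    decode (δ (colour (v′ , j′)) (v′ ⊕ β′)) ≡⟨ decode-δ-colour v′ j′ d′ ⟩
    toℕ j′                                  ∎
    where open ≡-Reasoning

  same-colour-common-vertex : ∀ p p′ {x} → colour p ≡ colour p′ →
    HasVertex (star p) x → HasVertex (star p′) x → p ≡ p′
  same-colour-common-vertex (v , j) (v′ , j′) same x∈ x∈′
    with toℕ-injective {i = j} {j = j′} (same-colour-common-vertex⇒same-layer same x∈ x∈′)
  ... | refl = cong (_, j) (⊕-cancelʳ (toℕ≤N j) same)

  colour-surjective : Surjective _≡_ _≡_ (colour ∘ remQuot K)
  colour-surjective c = combine c Fin.zero , λ {b} b≡ → begin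
    colour (remQuot K b)                      ≡⟨ cong (colour ∘ remQuot K) b≡ ⟩
    colour (remQuot K (combine c Fin.zero))   ≡⟨ cong colour (remQuot-combine c Fin.zero) ⟩
    c ⊕ 0                                     ≡⟨ ⊕-identityʳ c ⟩
    c                                         ∎
    where open ≡-Reasoning

  colourable : BlockColourable starSystem N
  colourable = colour ∘ remQuot K , colour-surjective , λ b b′ b≢b′ same x x∈ x∈′ →
    b≢b′ (remQuot-injective K (same-colour-common-vertex (remQuot K b) (remQuot K b′) same x∈ x∈′))

order-identity : ∀ q e₁ → suc q * (4 * suc e₁) ≡ suc (suc (2 * (e₁ + suc (2 * q) * suc e₁)))
order-identity = solve-∀

theorem3p1 : (e n : ℕ) → 3 ≤ e → 1 ≤ n → (4 * e) ∣ n →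
    Σ (StarSystem n e) λ S → BlockColourable S (n ∸ 1)
theorem3p1 (suc e₁) n (s≤s _) 0<n (divides zero n≡0) = contradiction n≡0 (m<n⇒n≢0 0<n)
theorem3p1 (suc e₁) n (s≤s _) _ (divides (suc q) refl) =
  subst (λ n → Σ (StarSystem n (suc e₁)) λ S → BlockColourable S (n ∸ 1)) (sym (order-identity q e₁))
    (starSystem , colourable)
  where open CyclicStarSystem e₁ (suc (2 * q))
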